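{- There exists a positive integer $K_0$ such that for every integer $K\ge K_0$, $$\sum_{n\le K}\sigma(30n)>\sum_{n\le K}\sigma(30n+1),$$ where the sums are over positive integers $n\le K$.
   Context: $\sigma(n)=\sum_{d\mid n} d$ denotes the sum of the positive divisors of the positive integer $n$. -}

module Defs where

open import Data.Nat using (ℕ; zero; suc; _+_; _*_)
open import Data.Nat.Divisibility using (_∣_; _∣?_)
open import Data.List using (List; []; _∷_; filter; map)
open import Data.Nat.ListAction using (sum)

range1 : ℕ → List ℕ
range1 zero = []
range1 (suc n) = range1 n Data.List.++ (suc n ∷ [])

-- σ(n) = sum of positive divisors d of n (d ranges over 1..n); σ(0) = 0 (unused)
σ : ℕ → ℕ
σ n = sum (filter (λ d → d ∣? n) (range1 n))

sumTo : ℕ → (ℕ → ℕ) → ℕ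
sumTo K f = sum (map f (range1 K))

-- Write σ m as the sum of the codivisors m / b over b ∣ m. Then σ (30 n) ≥ n σ 30 = 72 n, so the
-- left-hand side is at least 36 K (K + 1). On the right, exchanging the two sums gives
-- ∑_b ∑_{n ≤ K, b ∣ 30 n + 1} (30 n + 1) / b, where only b coprime to 30 occur. The term b = 1 is
-- 15 K (K + 1) + K. For 7 ≤ b ≤ K, admissible n differ by multiples of b, so at most 2K/b of them
-- occur and the term is at most 2K (30 K + 1) / b²; and ∑_{b ≥ 7} 1/b² ≤ 1/6. Each of the 29 K + 1
-- values b > K admits at most one n and contributes at most 30. So the right-hand side is about
-- 25 K², against 36 K² on the left.

{-# OPTIONS --safe #-}
module Submission where

open import Defs
open import Data.Bool using (true; false; if_then_else_)
open import Data.List using ([]; _∷_; filter; map; _++_)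
open import Data.List.Properties using (map-++)
open import Data.Nat using (ℕ; zero; suc; _+_; _*_; _∸_; _≤_; _<_; z≤n; s≤s; _≟_; _≤?_; NonZero; >-nonZero; >-nonZero⁻¹)
open import Data.Nat.Coprimality using (Coprime; coprime-divisor)
open import Data.Nat.Divisibility
open import Data.Nat.ListAction using (sum)
open import Data.Nat.ListAction.Properties using (sum-++)
open import Data.Nat.Properties
open import Algebra.Properties.CommutativeSemigroup +-commutativeSemigroup using (interchange)
open import Algebra.Properties.CommutativeSemigroup *-commutativeSemigroup using (x∙yz≈y∙xz)
open import Data.Nat.Tactic.RingSolver using (solve-∀)
open import Data.Empty using (⊥-elim)
open import Data.Product using (Σ; _×_; _,_)
open import Relation.Binary.PropositionalEquality
open import Relation.Nullary using (yes; no; ¬_; does; contradiction)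
open import Relation.Unary using (Decidable)

∑ : ℕ → (ℕ → ℕ) → ℕ
∑ zero    f = 0
∑ (suc n) f = ∑ n f + f (suc n)

sumTo≡∑ : ∀ n f → sumTo n f ≡ ∑ n f
sumTo≡∑ zero    f = refl
sumTo≡∑ (suc n) f = begin
  sum (map f (range1 n ++ suc n ∷ []))      ≡⟨ cong sum (map-++ f (range1 n) (suc n ∷ [])) ⟩
  sum (map f (range1 n) ++ f (suc n) ∷ [])  ≡⟨ sum-++ (map f (range1 n)) (f (suc n) ∷ []) ⟩
  sumTo n f + (f (suc n) + 0)               ≡⟨ cong₂ _+_ (sumTo≡∑ n f) (+-identityʳ (f (suc n))) ⟩
  ∑ n f + f (suc n)                         ∎
  where open ≡-Reasoning

∑-cong : ∀ n {f g} → (∀ i → 1 ≤ i → i ≤ n → f i ≡ g i) → ∑ n f ≡ ∑ n g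
∑-cong zero    f≡g = refl
∑-cong (suc n) f≡g =
  cong₂ _+_ (∑-cong n λ i 1≤i i≤n → f≡g i 1≤i (m≤n⇒m≤1+n i≤n)) (f≡g (suc n) (s≤s z≤n) ≤-refl)

∑-mono-≤ : ∀ n {f g} → (∀ i → 1 ≤ i → i ≤ n → f i ≤ g i) → ∑ n f ≤ ∑ n g
∑-mono-≤ zero    f≤g = z≤n
∑-mono-≤ (suc n) f≤g =
  +-mono-≤ (∑-mono-≤ n λ i 1≤i i≤n → f≤g i 1≤i (m≤n⇒m≤1+n i≤n)) (f≤g (suc n) (s≤s z≤n) ≤-refl)

∑-const : ∀ n c → ∑ n (λ _ → c) ≡ n * c
∑-const zero    c = refl
∑-const (suc n) c = trans (cong (_+ c) (∑-const n c)) (+-comm (n * c) c)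

∑-zero : ∀ n {f} → (∀ i → 1 ≤ i → i ≤ n → f i ≡ 0) → ∑ n f ≡ 0
∑-zero n f≡0 = trans (∑-cong n f≡0) (trans (∑-const n 0) (*-zeroʳ n))

∑-distrib-+ : ∀ n f g → ∑ n (λ i → f i + g i) ≡ ∑ n f + ∑ n g
∑-distrib-+ zero    f g = refl
∑-distrib-+ (suc n) f g =
  trans (cong (_+ (f (suc n) + g (suc n))) (∑-distrib-+ n f g)) (interchange (∑ n f) (∑ n g) _ _)

∑-distribˡ-* : ∀ n c f → ∑ n (λ i → c * f i) ≡ c * ∑ n f
∑-distribˡ-* zero    c f = sym (*-zeroʳ c)
∑-distribˡ-* (suc n) c f =
  trans (cong (_+ c * f (suc n)) (∑-distribˡ-* n c f)) (sym (*-distribˡ-+ c (∑ n f) (f (suc n))))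

∑-comm : ∀ m n (f : ℕ → ℕ → ℕ) → ∑ m (λ i → ∑ n (f i)) ≡ ∑ n (λ j → ∑ m (λ i → f i j))
∑-comm zero    n f = sym (∑-zero n λ _ _ _ → refl)
∑-comm (suc m) n f =
  trans (cong (_+ ∑ n (f (suc m))) (∑-comm m n f)) (sym (∑-distrib-+ n _ (f (suc m))))

∑-split : ∀ m k f → ∑ (m + k) f ≡ ∑ m f + ∑ k (λ i → f (m + i))
∑-split m zero    f = trans (cong (λ n → ∑ n f) (+-identityʳ m)) (sym (+-identityʳ (∑ m f)))
∑-split m (suc k) f = begin
  ∑ (m + suc k) f                                   ≡⟨ cong (λ n → ∑ n f) (+-suc m k) ⟩
  ∑ (m + k) f + f (suc (m + k))                     ≡⟨ cong₂ _+_ (∑-split m k f) (cong f (sym (+-suc m k))) ⟩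
  ∑ m f + ∑ k (λ i → f (m + i)) + f (m + suc k)     ≡⟨ +-assoc (∑ m f) _ _ ⟩
  ∑ m f + (∑ k (λ i → f (m + i)) + f (m + suc k))   ∎
  where open ≡-Reasoning

∑-mono-range : ∀ f {m n} → m ≤ n → ∑ m f ≤ ∑ n f
∑-mono-range f {m} {n} m≤n = begin
  ∑ m f                                    ≤⟨ m≤m+n (∑ m f) _ ⟩
  ∑ m f + ∑ (n ∸ m) (λ i → f (m + i))      ≡⟨ ∑-split m (n ∸ m) f ⟨
  ∑ (m + (n ∸ m)) f                        ≡⟨ cong (λ k → ∑ k f) (m+[n∸m]≡n m≤n) ⟩
  ∑ n f                                    ∎
  where open ≤-Reasoning

∑-single : ∀ n {f} j → 1 ≤ j → j ≤ n → (∀ i → i ≢ j → f i ≡ 0) → ∑ n f ≡ f j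
∑-single zero    j (s≤s _) ()
∑-single (suc n) {f} j 1≤j j≤1+n others with suc n ≟ j
... | yes refl = cong (_+ f (suc n)) (∑-zero n λ i _ i≤n → others i (<⇒≢ (s≤s i≤n)))
... | no 1+n≢j = trans
  (cong₂ _+_ (∑-single n j 1≤j (≤-pred (≤∧≢⇒< j≤1+n (≢-sym 1+n≢j))) others) (others (suc n) 1+n≢j))
  (+-identityʳ (f j))

sum-filter : ∀ {P : ℕ → Set} (P? : Decidable P) xs →
             sum (filter P? xs) ≡ sum (map (λ x → if does (P? x) then x else 0) xs)
sum-filter P? []       = refl
sum-filter P? (x ∷ xs) with does (P? x)
... | true  = cong (x +_) (sum-filter P? xs)
... | false = sum-filter P? xs

σ≡∑ : ∀ m → σ m ≡ ∑ m (λ d → if does (d ∣? m) then d else 0)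
σ≡∑ m = trans (sum-filter (_∣? m) (range1 m)) (sumTo≡∑ m _)

codivisor : ℕ → ℕ → ℕ
codivisor m b with b ∣? m
... | yes b∣m = quotient b∣m
... | no  _   = 0

𝟙[_∣_] : ℕ → ℕ → ℕ
𝟙[ b ∣ m ] = if does (b ∣? m) then 1 else 0

*-codivisor : ∀ m b → b * codivisor m b ≡ m * 𝟙[ b ∣ m ]
*-codivisor m b with b ∣? m
... | yes (divides q m≡q*b) = trans (*-comm b q) (trans (sym m≡q*b) (sym (*-identityʳ m)))
... | no  _                 = trans (*-zeroʳ b) (sym (*-zeroʳ m))

codivisor-1 : ∀ m → codivisor m 1 ≡ m
codivisor-1 m with 1 ∣? m
... | yes (divides q m≡q*1) = sym (trans m≡q*1 (*-identityʳ q))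
... | no  1∤m               = contradiction (1∣ m) 1∤m

codivisor-* : ∀ m n b .{{_ : NonZero b}} → n * codivisor m b ≤ codivisor (m * n) b
codivisor-* m n b with b ∣? m | b ∣? m * n
... | yes (divides q m≡q*b) | yes (divides r mn≡r*b) = ≤-reflexive (sym (*-cancelʳ-≡ r (n * q) b (begin
  r * b        ≡⟨ mn≡r*b ⟨
  m * n        ≡⟨ *-comm m n ⟩
  n * m        ≡⟨ cong (n *_) m≡q*b ⟩
  n * (q * b)  ≡⟨ *-assoc n q b ⟨
  n * q * b    ∎)))
  where open ≡-Reasoning
... | yes b∣m | no b∤mn = contradiction (∣m⇒∣m*n n b∣m) b∤mn
... | no  _   | _       = ≤-trans (≤-reflexive (*-zeroʳ n)) z≤n

leftFactor : ℕ → ℕ → ℕ → ℕ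
leftFactor m a b with a * b ≟ m
... | yes _ = a
... | no  _ = 0

leftFactor-≡ : ∀ m a b → a * b ≡ m → leftFactor m a b ≡ a
leftFactor-≡ m a b ab≡m with a * b ≟ m
... | yes _    = refl
... | no  ab≢m = contradiction ab≡m ab≢m

leftFactor-≢ : ∀ m a b → a * b ≢ m → leftFactor m a b ≡ 0
leftFactor-≢ m a b ab≢m with a * b ≟ m
... | yes ab≡m = contradiction ab≡m ab≢m
... | no  _    = refl

∑-leftFactor≡divisor : ∀ M {m} a .{{_ : NonZero a}} .{{_ : NonZero m}} → m ≤ M →
                       ∑ M (leftFactor m a) ≡ (if does (a ∣? m) then a else 0)
∑-leftFactor≡divisor M {m} a m≤M with a ∣? m
... | no a∤m = ∑-zero M λ b _ _ → leftFactor-≢ m a b λ ab≡m → a∤m (divides b (trans (sym ab≡m) (*-comm a b)))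
... | yes a∣m@(divides q m≡q*a) =
  trans (∑-single M q (>-nonZero⁻¹ q {{quotient≢0 a∣m}}) q≤M others) (leftFactor-≡ m a q (trans (*-comm a q) (sym m≡q*a)))
  where
  q≤M : q ≤ M
  q≤M = ≤-trans (m≤m*n q a) (≤-trans (≤-reflexive (sym m≡q*a)) m≤M)
  others : ∀ b → b ≢ q → leftFactor m a b ≡ 0
  others b b≢q = leftFactor-≢ m a b λ ab≡m → b≢q (*-cancelˡ-≡ b q a (trans ab≡m (trans m≡q*a (*-comm q a))))

∑-leftFactor≡codivisor : ∀ {m} b .{{_ : NonZero b}} .{{_ : NonZero m}} →
                    ∑ m (λ a → leftFactor m a b) ≡ codivisor m b
∑-leftFactor≡codivisor {m} b with b ∣? m
... | no b∤m = ∑-zero m λ a _ _ → leftFactor-≢ m a b λ ab≡m → b∤m (divides a (sym ab≡m))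
... | yes b∣m@(divides q m≡q*b) =
  trans (∑-single m q (>-nonZero⁻¹ q {{quotient≢0 b∣m}}) q≤m others) (leftFactor-≡ m q b (sym m≡q*b))
  where
  q≤m : q ≤ m
  q≤m = ≤-trans (m≤m*n q b) (≤-reflexive (sym m≡q*b))
  others : ∀ a → a ≢ q → leftFactor m a b ≡ 0
  others a a≢q = leftFactor-≢ m a b λ ab≡m → a≢q (*-cancelʳ-≡ a q b (trans ab≡m m≡q*b))

σ≡∑codivisor : ∀ m {M} .{{_ : NonZero m}} → m ≤ M → σ m ≡ ∑ M (codivisor m)
σ≡∑codivisor m {M} m≤M = begin
  σ m                                          ≡⟨ σ≡∑ m ⟩
  ∑ m (λ a → if does (a ∣? m) then a else 0)   ≡⟨ ∑-cong m (λ a 1≤a _ → sym (∑-leftFactor≡divisor M a {{>-nonZero 1≤a}} m≤M)) ⟩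
  ∑ m (λ a → ∑ M (leftFactor m a))             ≡⟨ ∑-comm m M (leftFactor m) ⟩
  ∑ M (λ b → ∑ m (λ a → leftFactor m a b))     ≡⟨ ∑-cong M (λ b 1≤b _ → ∑-leftFactor≡codivisor b {{>-nonZero 1≤b}}) ⟩
  ∑ M (codivisor m)                            ∎
  where open ≡-Reasoning

n*σ[m]≤σ[m*n] : ∀ m n → n * σ m ≤ σ (m * n)
n*σ[m]≤σ[m*n] zero          n       = ≤-reflexive (*-zeroʳ n)
n*σ[m]≤σ[m*n] (suc _)       zero    = z≤n
n*σ[m]≤σ[m*n] m@(suc _) n@(suc _) = begin
  n * σ m                          ≡⟨ cong (n *_) (σ≡∑codivisor m ≤-refl) ⟩
  n * ∑ m (codivisor m)            ≡⟨ ∑-distribˡ-* m n _ ⟨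
  ∑ m (λ b → n * codivisor m b)    ≤⟨ ∑-mono-≤ m (λ b 1≤b _ → codivisor-* m n b {{>-nonZero 1≤b}}) ⟩
  ∑ m (codivisor (m * n))          ≤⟨ ∑-mono-range _ (m≤m*n m n) ⟩
  ∑ (m * n) (codivisor (m * n))    ≡⟨ σ≡∑codivisor (m * n) ≤-refl ⟨
  σ (m * n)                        ∎
  where open ≤-Reasoning

∑-linear : ∀ c n → ∑ n (λ i → 2 * c * i) ≡ c * (n * suc n)
∑-linear c zero    = sym (*-zeroʳ c)
∑-linear c (suc n) = trans (cong (_+ 2 * c * suc n) (∑-linear c n)) (step c n)
  where
  step : ∀ c n → c * (n * suc n) + 2 * c * suc n ≡ c * (suc n * suc (suc n))
  step = solve-∀

36K[K+1]≤∑σ[30n] : ∀ K → 36 * (K * suc K) ≤ ∑ K (λ n → σ (30 * n))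
36K[K+1]≤∑σ[30n] K = begin
  36 * (K * suc K)          ≡⟨ ∑-linear 36 K ⟨
  ∑ K (λ n → 72 * n)        ≤⟨ ∑-mono-≤ K (λ n _ _ → subst (_≤ σ (30 * n)) (*-comm n 72) (n*σ[m]≤σ[m*n] 30 n)) ⟩
  ∑ K (λ n → σ (30 * n))    ∎
  where open ≤-Reasoning

∣a*n+1⇒coprime : ∀ a {b} n → b ∣ a * n + 1 → Coprime b a
∣a*n+1⇒coprime a n b∣an+1 (d∣b , d∣a) = ∣1⇒≡1 (∣m+n∣m⇒∣n (∣-trans d∣b b∣an+1) (∣m⇒∣m*n n d∣a))

∣a*n+1-gap : ∀ a {b} x d → b ∣ a * x + 1 → b ∣ a * (x + d) + 1 → b ∣ d
∣a*n+1-gap a {b} x d b∣ax+1 b∣a[x+d]+1 =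
  coprime-divisor (∣a*n+1⇒coprime a x b∣ax+1) (∣m+n∣m⇒∣n (subst (b ∣_) (shift a x d) b∣a[x+d]+1) b∣ax+1)
  where
  shift : ∀ a x d → a * (x + d) + 1 ≡ (a * x + 1) + a * d
  shift = solve-∀

hits : ℕ → ℕ → ℕ → ℕ → ℕ
hits a b x k = ∑ k (λ i → 𝟙[ b ∣ a * (x + i) + 1 ])

hits-+ : ∀ a b x m k → hits a b x (m + k) ≡ hits a b x m + hits a b (x + m) k
hits-+ a b x m k = trans (∑-split m k _)
  (cong (hits a b x m +_) (∑-cong k λ i _ _ → cong (λ y → 𝟙[ b ∣ a * y + 1 ]) (sym (+-assoc x m i))))

hits-window : ∀ a b x k → k ≤ b → hits a b x k ≤ 1
hits-window a b x zero    _   = z≤n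
hits-window a b x (suc k) k<b with b ∣? a * (x + suc k) + 1
... | no  _   = subst (_≤ 1) (sym (+-identityʳ _)) (hits-window a b x k (<⇒≤ k<b))
... | yes hit = ≤-reflexive (cong (_+ 1) (∑-zero k noEarlierHit))
  where
  noEarlierHit : ∀ i → 1 ≤ i → i ≤ k → 𝟙[ b ∣ a * (x + i) + 1 ] ≡ 0
  noEarlierHit i 1≤i i≤k with b ∣? a * (x + i) + 1
  ... | no  _    = refl
  ... | yes hitᵢ = contradiction b≤1+k-i (<⇒≱ 1+k-i<b)
    where
    x+[1+k]≡x+i+[1+k-i] : x + suc k ≡ x + i + suc (k ∸ i)
    x+[1+k]≡x+i+[1+k-i] = trans (cong (x +_) (sym (trans (+-suc i (k ∸ i)) (cong suc (m+[n∸m]≡n i≤k))))) (sym (+-assoc x i _))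
    1+k-i<b : suc (k ∸ i) < b
    1+k-i<b = ≤-trans (s≤s (≤-trans (+-monoˡ-≤ (k ∸ i) 1≤i) (≤-reflexive (m+[n∸m]≡n i≤k)))) k<b
    b≤1+k-i : b ≤ suc (k ∸ i)
    b≤1+k-i = ∣⇒≤ (∣a*n+1-gap a (x + i) (suc (k ∸ i)) hitᵢ (subst (λ y → b ∣ a * y + 1) x+[1+k]≡x+i+[1+k-i] hit))

-- q bounds the number of blocks of length b into which the window is cut.
hits-blocks : ∀ a b .{{_ : NonZero b}} q x k → k ≤ q * b → b * hits a b x k ≤ k + b
hits-blocks a b zero    x zero    _ = ≤-trans (≤-reflexive (*-zeroʳ b)) z≤n
hits-blocks a b (suc q) x k k≤[1+q]b with k ≤? b
... | yes k≤b = ≤-trans (*-monoʳ-≤ b (hits-window a b x k k≤b)) (≤-trans (≤-reflexive (*-identityʳ b)) (m≤n+m b k))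
... | no  k≰b = begin
  b * hits a b x k                                ≡⟨ cong (λ k → b * hits a b x k) b+k′≡k ⟨
  b * hits a b x (b + k′)                         ≡⟨ cong (b *_) (hits-+ a b x b k′) ⟩
  b * (hits a b x b + hits a b (x + b) k′)        ≡⟨ *-distribˡ-+ b _ _ ⟩
  b * hits a b x b + b * hits a b (x + b) k′      ≤⟨ +-mono-≤ (≤-trans (*-monoʳ-≤ b (hits-window a b x b ≤-refl)) (≤-reflexive (*-identityʳ b)))
                                                               (hits-blocks a b q (x + b) k′ k′≤qb) ⟩
  b + (k′ + b)                                    ≡⟨ +-assoc b k′ b ⟨
  b + k′ + b                                      ≡⟨ cong (_+ b) b+k′≡k ⟩
  k + b                                           ∎
  where
  open ≤-Reasoning
  k′ = k ∸ b
  b+k′≡k : b + k′ ≡ k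
  b+k′≡k = m+[n∸m]≡n (<⇒≤ (≰⇒> k≰b))
  k′≤qb : k′ ≤ q * b
  k′≤qb = +-cancelˡ-≤ b _ _ (subst (_≤ b + q * b) (sym b+k′≡k) k≤[1+q]b)

hits-bound : ∀ a b .{{_ : NonZero b}} k → b * hits a b 0 k ≤ k + b
hits-bound a b k = hits-blocks a b k 0 k (m≤m*n k b)

codivisorSum : ℕ → ℕ → ℕ → ℕ
codivisorSum a K b = ∑ K (λ n → codivisor (a * n + 1) b)

∑σ[a*n+1]≡∑codivisorSum : ∀ a K → ∑ K (λ n → σ (a * n + 1)) ≡ ∑ (a * K + 1) (codivisorSum a K)
∑σ[a*n+1]≡∑codivisorSum a K = trans
  (∑-cong K λ n _ n≤K → σ≡∑codivisor (a * n + 1) {{>-nonZero (m≤n+m 1 (a * n))}} (+-monoˡ-≤ 1 (*-monoʳ-≤ a n≤K)))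
  (∑-comm K (a * K + 1) (λ n → codivisor (a * n + 1)))

codivisorSum-1 : ∀ a K → codivisorSum a K 1 ≡ ∑ K (λ n → a * n + 1)
codivisorSum-1 a K = ∑-cong K λ n _ _ → codivisor-1 (a * n + 1)

codivisorSum-¬coprime : ∀ a K b → ¬ Coprime b a → codivisorSum a K b ≡ 0
codivisorSum-¬coprime a K b b≁a = ∑-zero K vanishes
  where
  vanishes : ∀ n → 1 ≤ n → n ≤ K → codivisor (a * n + 1) b ≡ 0
  vanishes n _ _ with b ∣? a * n + 1
  ... | yes b∣an+1 = ⊥-elim (b≁a (∣a*n+1⇒coprime a n b∣an+1))
  ... | no  _      = refl

*-codivisorSum≤ : ∀ a K b → b * codivisorSum a K b ≤ (a * K + 1) * hits a b 0 K
*-codivisorSum≤ a K b = begin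
  b * codivisorSum a K b                          ≡⟨ ∑-distribˡ-* K b _ ⟨
  ∑ K (λ n → b * codivisor (a * n + 1) b)         ≡⟨ ∑-cong K (λ n _ _ → *-codivisor (a * n + 1) b) ⟩
  ∑ K (λ n → (a * n + 1) * 𝟙[ b ∣ a * n + 1 ])    ≤⟨ ∑-mono-≤ K (λ n _ n≤K → *-monoˡ-≤ _ (+-monoˡ-≤ 1 (*-monoʳ-≤ a n≤K))) ⟩
  ∑ K (λ n → (a * K + 1) * 𝟙[ b ∣ a * n + 1 ])    ≡⟨ ∑-distribˡ-* K (a * K + 1) _ ⟩
  (a * K + 1) * hits a b 0 K                      ∎
  where open ≤-Reasoning

codivisorSum-small : ∀ a K b .{{_ : NonZero b}} → b ≤ K → b * b * codivisorSum a K b ≤ (a * K + 1) * (K + K)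
codivisorSum-small a K b b≤K = begin
  b * b * codivisorSum a K b              ≡⟨ *-assoc b b _ ⟩
  b * (b * codivisorSum a K b)            ≤⟨ *-monoʳ-≤ b (*-codivisorSum≤ a K b) ⟩
  b * ((a * K + 1) * hits a b 0 K)        ≡⟨ x∙yz≈y∙xz b (a * K + 1) _ ⟩
  (a * K + 1) * (b * hits a b 0 K)        ≤⟨ *-monoʳ-≤ (a * K + 1) (≤-trans (hits-bound a b K) (+-monoʳ-≤ K b≤K)) ⟩
  (a * K + 1) * (K + K)                   ∎
  where open ≤-Reasoning

codivisorSum-large : ∀ a K b → 1 ≤ a → K < b → codivisorSum a K b ≤ a
codivisorSum-large a K b@(suc _) 1≤a K<b = *-cancelˡ-≤ b (begin
  b * codivisorSum a K b          ≤⟨ *-codivisorSum≤ a K b ⟩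
  (a * K + 1) * hits a b 0 K      ≤⟨ *-monoʳ-≤ (a * K + 1) (hits-window a b 0 K (<⇒≤ K<b)) ⟩
  (a * K + 1) * 1                 ≡⟨ *-identityʳ _ ⟩
  a * K + 1                       ≤⟨ +-monoʳ-≤ (a * K) 1≤a ⟩
  a * K + a                       ≡⟨ trans (+-comm (a * K) a) (sym (*-suc a K)) ⟩
  a * suc K                       ≤⟨ *-monoʳ-≤ a K<b ⟩
  a * b                           ≡⟨ *-comm a b ⟩
  b * a                           ∎)
  where open ≤-Reasoning

inverse-square-step : ∀ m d X T t →
  m * suc d * T + m * X ≤ X * suc d → suc (suc d) * suc (suc d) * t ≤ X →
  m * suc (suc d) * (T + t) + m * X ≤ X * suc (suc d)
inverse-square-step m d X T t invariant D′²t≤X = *-cancelˡ-≤ D (+-cancelʳ-≤ (m * X * D′) _ _ (begin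
  D * (m * D′ * (T + t) + m * X) + m * X * D′            ≡⟨ regroup m D X T t ⟩
  D′ * (m * D * T + m * X) + m * (D * (D′ * t)) + m * X * D
     ≤⟨ +-monoˡ-≤ (m * X * D) (+-mono-≤ (*-monoʳ-≤ D′ invariant) (*-monoʳ-≤ m DD′t≤X)) ⟩
  D′ * (X * D) + m * X + m * X * D                        ≡⟨ regroup′ m D X ⟩
  D * (X * D′) + m * X * D′                               ∎))
  where
  open ≤-Reasoning
  D = suc d
  D′ = suc D
  DD′t≤X : D * (D′ * t) ≤ X
  DD′t≤X = ≤-trans (*-monoˡ-≤ (D′ * t) (n≤1+n D)) (≤-trans (≤-reflexive (sym (*-assoc D′ D′ t))) D′²t≤X)
  regroup : ∀ m D X T t → D * (m * suc D * (T + t) + m * X) + m * X * suc D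
                         ≡ suc D * (m * D * T + m * X) + m * (D * (suc D * t)) + m * X * D
  regroup = solve-∀
  regroup′ : ∀ m D X → suc D * (X * D) + m * X + m * X * D ≡ D * (X * suc D) + m * X * suc D
  regroup′ = solve-∀

-- ∑_{m < b ≤ m + j} t b ≤ X (1/m − 1/(m + j)) with denominators cleared; it is inductive
-- because 1/(D + 1)² ≤ 1/D − 1/(D + 1).
inverse-square-invariant : ∀ m X (t : ℕ → ℕ) j → (∀ i → 1 ≤ i → i ≤ j → (m + i) * (m + i) * t (m + i) ≤ X) →
                           m * (m + j) * ∑ j (λ i → t (m + i)) + m * X ≤ X * (m + j)
inverse-square-invariant zero        X t j       _      = z≤n
inverse-square-invariant m@(suc _)   X t zero    _      = ≤-reflexive (base m X)
  where
  base : ∀ m X → m * (m + 0) * 0 + m * X ≡ X * (m + 0)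
  base = solve-∀
inverse-square-invariant m@(suc m′) X t (suc j) bound =
  subst (λ D → m * D * (∑ j (λ i → t (m + i)) + t D) + m * X ≤ X * D) (sym (+-suc m j))
    (inverse-square-step m (m′ + j) X (∑ j (λ i → t (m + i))) (t (suc (m + j)))
      (inverse-square-invariant m X t j λ i 1≤i i≤j → bound i 1≤i (m≤n⇒m≤1+n i≤j))
      (subst (λ D → D * D * t D ≤ X) (+-suc m j) (bound (suc j) (s≤s z≤n) ≤-refl)))

∑-inverse-square : ∀ m X (t : ℕ → ℕ) j → (∀ i → 1 ≤ i → i ≤ j → (m + i) * (m + i) * t (m + i) ≤ X) →
                   m * ∑ j (λ i → t (m + i)) ≤ X
∑-inverse-square zero      X t j _     = z≤n
∑-inverse-square m@(suc _) X t j bound = *-cancelˡ-≤ (m + j) (begin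
  (m + j) * (m * T)             ≡⟨ trans (x∙yz≈y∙xz (m + j) m T) (sym (*-assoc m (m + j) T)) ⟩
  m * (m + j) * T               ≤⟨ m≤m+n _ (m * X) ⟩
  m * (m + j) * T + m * X       ≤⟨ inverse-square-invariant m X t j bound ⟩
  X * (m + j)                   ≡⟨ *-comm X (m + j) ⟩
  (m + j) * X                   ∎)
  where
  open ≤-Reasoning
  T = ∑ j (λ i → t (m + i))

¬coprime[b,30] : ∀ b → 2 ≤ b → b ≤ 6 → ¬ Coprime b 30
¬coprime[b,30] 0 () _
¬coprime[b,30] 1 (s≤s ()) _
¬coprime[b,30] 2 _ _ b⊥30 = contradiction (b⊥30 {2} (divides 1 refl , divides 15 refl)) λ ()
¬coprime[b,30] 3 _ _ b⊥30 = contradiction (b⊥30 {3} (divides 1 refl , divides 10 refl)) λ ()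
¬coprime[b,30] 4 _ _ b⊥30 = contradiction (b⊥30 {2} (divides 2 refl , divides 15 refl)) λ ()
¬coprime[b,30] 5 _ _ b⊥30 = contradiction (b⊥30 {5} (divides 1 refl , divides 6 refl)) λ ()
¬coprime[b,30] 6 _ _ b⊥30 = contradiction (b⊥30 {2} (divides 3 refl , divides 15 refl)) λ ()
¬coprime[b,30] (suc (suc (suc (suc (suc (suc (suc _))))))) _ (s≤s (s≤s (s≤s (s≤s (s≤s (s≤s ()))))))

∑₆codivisorSum : ∀ K → ∑ 6 (codivisorSum 30 K) ≡ ∑ K (λ n → 30 * n + 1)
∑₆codivisorSum K = begin
  ∑ (1 + 5) B                        ≡⟨ ∑-split 1 5 B ⟩
  ∑ 1 B + ∑ 5 (λ i → B (1 + i))      ≡⟨ cong (B 1 +_) (∑-zero 5 B[1+i]≡0) ⟩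
  B 1 + 0                            ≡⟨ +-identityʳ (B 1) ⟩
  B 1                                ≡⟨ codivisorSum-1 30 K ⟩
  ∑ K (λ n → 30 * n + 1)             ∎
  where
  open ≡-Reasoning
  B = codivisorSum 30 K
  B[1+i]≡0 : ∀ i → 1 ≤ i → i ≤ 5 → B (1 + i) ≡ 0
  B[1+i]≡0 i 1≤i i≤5 = codivisorSum-¬coprime 30 K (suc i) (¬coprime[b,30] (suc i) (s≤s 1≤i) (s≤s i≤5))

∑codivisorSum-head : ∀ K → 6 ≤ K →
  6 * ∑ K (codivisorSum 30 K) ≤ 6 * ∑ K (λ n → 30 * n + 1) + (30 * K + 1) * (K + K)
∑codivisorSum-head K 6≤K = begin
  6 * ∑ K B                                                 ≡⟨ cong (λ M → 6 * ∑ M B) 6+j≡K ⟨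
  6 * ∑ (6 + j) B                                           ≡⟨ cong (6 *_) (∑-split 6 j B) ⟩
  6 * (∑ 6 B + ∑ j (λ i → B (6 + i)))                       ≡⟨ cong (λ s → 6 * (s + ∑ j (λ i → B (6 + i)))) (∑₆codivisorSum K) ⟩
  6 * (∑ K (λ n → 30 * n + 1) + ∑ j (λ i → B (6 + i)))      ≡⟨ *-distribˡ-+ 6 (∑ K (λ n → 30 * n + 1)) (∑ j (λ i → B (6 + i))) ⟩
  6 * ∑ K (λ n → 30 * n + 1) + 6 * ∑ j (λ i → B (6 + i))    ≤⟨ +-monoʳ-≤ _ (∑-inverse-square 6 X B j λ i _ i≤j →
                                                                 codivisorSum-small 30 K (6 + i) (subst (6 + i ≤_) 6+j≡K (+-monoʳ-≤ 6 i≤j))) ⟩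
  6 * ∑ K (λ n → 30 * n + 1) + X                            ∎
  where
  open ≤-Reasoning
  j = K ∸ 6
  6+j≡K : 6 + j ≡ K
  6+j≡K = m+[n∸m]≡n 6≤K
  B = codivisorSum 30 K
  X = (30 * K + 1) * (K + K)

∑codivisorSum-tail : ∀ a K t → 1 ≤ a → ∑ t (λ i → codivisorSum a K (K + i)) ≤ t * a
∑codivisorSum-tail a K t 1≤a = ≤-trans
  (∑-mono-≤ t λ i 1≤i _ → codivisorSum-large a K (K + i) 1≤a (m<m+n K 1≤i))
  (≤-reflexive (∑-const t a))

∑σ[30n+1]-upper : ∀ K → 6 ≤ K →
  6 * ∑ K (λ n → σ (30 * n + 1)) ≤ 6 * ∑ K (λ n → 30 * n + 1) + (30 * K + 1) * (K + K) + 6 * ((29 * K + 1) * 30)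
∑σ[30n+1]-upper K 6≤K = begin
  6 * ∑ K (λ n → σ (30 * n + 1))                        ≡⟨ cong (6 *_) (∑σ[a*n+1]≡∑codivisorSum 30 K) ⟩
  6 * ∑ (30 * K + 1) B                                  ≡⟨ cong (λ M → 6 * ∑ M B) (30K+1≡K+[29K+1] K) ⟩
  6 * ∑ (K + (29 * K + 1)) B                            ≡⟨ cong (6 *_) (∑-split K (29 * K + 1) B) ⟩
  6 * (∑ K B + ∑ (29 * K + 1) (λ i → B (K + i)))        ≡⟨ *-distribˡ-+ 6 (∑ K B) (∑ (29 * K + 1) (λ i → B (K + i))) ⟩
  6 * ∑ K B + 6 * ∑ (29 * K + 1) (λ i → B (K + i))
    ≤⟨ +-mono-≤ (∑codivisorSum-head K 6≤K) (*-monoʳ-≤ 6 (∑codivisorSum-tail 30 K (29 * K + 1) (s≤s z≤n))) ⟩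
  6 * ∑ K (λ n → 30 * n + 1) + (30 * K + 1) * (K + K) + 6 * ((29 * K + 1) * 30) ∎
  where
  open ≤-Reasoning
  B = codivisorSum 30 K
  30K+1≡K+[29K+1] : ∀ K → 30 * K + 1 ≡ K + (29 * K + 1)
  30K+1≡K+[29K+1] = solve-∀

upper<lower : ∀ k → let K = k + 100 in
  6 * (15 * (K * suc K) + K * 1) + (30 * K + 1) * (K + K) + 6 * ((29 * K + 1) * 30) < 6 * (36 * (K * suc K))
upper<lower k = ≤-trans (m≤m+n _ _) (≤-reflexive (expand k))
  where
  expand : ∀ k → let K = k + 100 in
    suc (6 * (15 * (K * suc K) + K * 1) + (30 * K + 1) * (K + K) + 6 * ((29 * K + 1) * 30)) + (66 * (k * k) + 8098 * k + 149619)
    ≡ 6 * (36 * (K * suc K))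
  expand = solve-∀

∑σ[30n+1]<∑σ[30n] : ∀ k → let K = k + 100 in ∑ K (λ n → σ (30 * n + 1)) < ∑ K (λ n → σ (30 * n))
∑σ[30n+1]<∑σ[30n] k = *-cancelˡ-< 6 _ _ (begin-strict
  6 * ∑ K (λ n → σ (30 * n + 1))                                                      ≤⟨ ∑σ[30n+1]-upper K (≤-trans (≤ᵇ⇒≤ 6 100 _) (m≤n+m 100 k)) ⟩
  6 * ∑ K (λ n → 30 * n + 1) + (30 * K + 1) * (K + K) + 6 * ((29 * K + 1) * 30)       ≡⟨ cong (λ s → 6 * s + (30 * K + 1) * (K + K) + 6 * ((29 * K + 1) * 30)) ∑[30n+1] ⟩
  6 * (15 * (K * suc K) + K * 1) + (30 * K + 1) * (K + K) + 6 * ((29 * K + 1) * 30)   <⟨ upper<lower k ⟩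
  6 * (36 * (K * suc K))                                                              ≤⟨ *-monoʳ-≤ 6 (36K[K+1]≤∑σ[30n] K) ⟩
  6 * ∑ K (λ n → σ (30 * n))                                                          ∎)
  where
  open ≤-Reasoning
  K = k + 100
  ∑[30n+1] : ∑ K (λ n → 30 * n + 1) ≡ 15 * (K * suc K) + K * 1
  ∑[30n+1] = trans (∑-distrib-+ K (λ n → 30 * n) (λ _ → 1)) (cong₂ _+_ (∑-linear 15 K) (∑-const K 1))

theorem2 : Σ ℕ (λ K₀ → (0 < K₀) × ((K : ℕ) → K₀ ≤ K → sumTo K (λ n → σ (30 * n + 1)) < sumTo K (λ n → σ (30 * n))))
theorem2 = 100 , s≤s z≤n , λ K 100≤K →
  subst₂ _<_ (sym (sumTo≡∑ K _)) (sym (sumTo≡∑ K _))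
    (subst (λ K → ∑ K (λ n → σ (30 * n + 1)) < ∑ K (λ n → σ (30 * n))) (m∸n+n≡m 100≤K) (∑σ[30n+1]<∑σ[30n] (K ∸ 100)))
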